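{- Let $\mathcal B,\mathcal B^*$ be matroids on a finite set $X$ and $B\mapsto B^*$ a linking $\mathcal B\to\mathcal B^*$; let $\omega,\pi,a,z,\varepsilon$ be as in the context. Let $B\in\mathcal B$. If $B^*$ is a branching image in $\mathcal B^*$, then $B$ is a balanced basis of $\mathcal B$.
   Context: A pre-matroid on a finite set $X$ is a non-empty set of subsets of $X$ (bases). For $Y\subseteq X$, $x\notin Y$, $Y+x=Y\cup\{x\}$; for $y\in Y$, $Y-y=Y\setminus\{y\}$. An almost-basis of a pre-matroid $\mathcal C$ is $B-x$ with $B\in\mathcal C$, $x\in B$; $U(D)=\{x\notin D: D+x\in\mathcal C\}$. A matroid is a pre-matroid such that for all bases $B_1,B_2$ and $x\in B_1\setminus B_2$ there is $y\in B_2\setminus B_1$ with $B_1-x+y$ a basis. A transposition exchanges two distinct elements of $X$ and fixes the rest; it acts on subsets elementwise. A bijection $\mathcal B\to\mathcal B^*$, $B\mapsto B^*$, is a linking if for all $B\in\mathcal B$ and transpositions $\tau$: (L1) if $\tau(B)\in\mathcal B$ then $\tau(B^*)\in\mathcal B^*$ and $\tau(B^*)=\tau(B)^*$; (L2) if $\tau(B^*)\in\mathcal B^*$ then $\tau(B)\in\mathcal B$ and $\tau(B^*)=\tau(B)^*$. For a linear order $\rho$ and an almost-basis $D$ of a pre-matroid, $\varphi_\rho(D)=D+\min_\rho U(D)$ (computed in that pre-matroid). Let $\omega$ be a linear order on $X$, $a\ne z$ consecutive for $\omega$ with $a<_\omega z$, $\varepsilon$ the transposition of $a,z$, and $\pi$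 the linear order agreeing with $\omega$ except $z<_\pi a$. An almost-basis $D$ is branching if $\varphi_\omega(D)\ne\varphi_\pi(D)$. A basis is a branching image if it equals $\varphi_\omega(A)$ or $\varphi_\pi(A)$ for some branching almost-basis $A$ (of the same pre-matroid). An almost-basis $Q$ of $\mathcal B$ is balanced if $\varepsilon(Q)$ is an almost-basis of $\mathcal B$, $\varepsilon(\varphi_\omega(Q))=\varphi_\pi(\varepsilon(Q))$ and $\varepsilon(\varphi_\pi(Q))=\varphi_\omega(\varepsilon(Q))$. A basis $B\in\mathcal B$ is $\omega$-balanced if $\varepsilon(B)\in\mathcal B$ and every almost-basis $Q$ with $\varphi_\omega(Q)=B$ or $\varphi_\pi(Q)=\varepsilon(B)$ is balanced; $\pi$-balanced if $\varepsilon(B)\in\mathcal B$ and every almost-basis $Q$ with $\varphi_\pi(Q)=B$ or $\varphi_\omega(Q)=\varepsilon(B)$ is balanced; balanced if both. -}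

module Defs where

open import Data.Bool using (Bool; true; false; not; _∧_; if_then_else_)
open import Data.Nat using (ℕ)
open import Data.Fin using (Fin)
open import Data.Fin.Subset using (Subset; _∈_; _∉_; _∪_; ⁅_⁆; _-_)
import Data.Fin.Permutation.Components as PC
open import Data.Vec using (tabulate; lookup)
open import Data.List using (List; foldr)
open import Data.List.Base using (allFin)
open import Data.Maybe using (Maybe; just; nothing)
open import Data.Product using (Σ; _×_; ∃; ∃-syntax)
open import Data.Sum using (_⊎_)
open import Level using (0ℓ)
open import Relation.Binary.Structures using (IsStrictTotalOrder)
open import Relation.Binary.PropositionalEquality using (_≡_; _≢_)
open import Relation.Nullary using (¬_; does)

-- The ground set X is Fin n; subsets are Data.Fin.Subset (Vec Bool n).
-- A family of subsets (a pre-matroid, when nonempty) is a Bool-valued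
-- predicate on subsets: 𝓒 S ≡ true means S ∈ 𝓒.
Family : ℕ → Set
Family n = Subset n → Bool

module _ {n : ℕ} where

  infix 4 _∈ᶠ_
  _∈ᶠ_ : Subset n → Family n → Set
  S ∈ᶠ 𝓒 = 𝓒 S ≡ true

  _+ₛ_ : Subset n → Fin n → Subset n
  Y +ₛ x = Y ∪ ⁅ x ⁆

  IsPreMatroid : Family n → Set
  IsPreMatroid 𝓒 = ∃[ B ] B ∈ᶠ 𝓒

  IsMatroid : Family n → Set
  IsMatroid 𝓒 = IsPreMatroid 𝓒 ×
    (∀ B₁ B₂ x → B₁ ∈ᶠ 𝓒 → B₂ ∈ᶠ 𝓒 → x ∈ B₁ → x ∉ B₂ →
       ∃[ y ] (y ∈ B₂ × y ∉ B₁ × ((B₁ - x) +ₛ y) ∈ᶠ 𝓒))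

  swapₛ : Fin n → Fin n → Subset n → Subset n
  swapₛ i j S = tabulate (λ x → lookup S (PC.transpose i j x))

  IsBijectionBetween : Family n → Family n → (Subset n → Subset n) → Set
  IsBijectionBetween 𝓑 𝓑* f =
    (∀ B → B ∈ᶠ 𝓑 → f B ∈ᶠ 𝓑*) ×
    (∀ B B′ → B ∈ᶠ 𝓑 → B′ ∈ᶠ 𝓑 → f B ≡ f B′ → B ≡ B′) ×
    (∀ C → C ∈ᶠ 𝓑* → ∃[ B ] (B ∈ᶠ 𝓑 × f B ≡ C))

  IsLinking : Family n → Family n → (Subset n → Subset n) → Set
  IsLinking 𝓑 𝓑* f = IsBijectionBetween 𝓑 𝓑* f ×
    (∀ B i j → B ∈ᶠ 𝓑 → i ≢ j →
       (swapₛ i j B ∈ᶠ 𝓑 → swapₛ i j (f B) ∈ᶠ 𝓑* × swapₛ i j (f B) ≡ f (swapₛ i j B)) ×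
       (swapₛ i j (f B) ∈ᶠ 𝓑* → swapₛ i j B ∈ᶠ 𝓑 × swapₛ i j (f B) ≡ f (swapₛ i j B)))

record LinearOrder (n : ℕ) : Set₁ where
  field
    _<_ : Fin n → Fin n → Set
    isSTO : IsStrictTotalOrder _≡_ _<_
  open IsStrictTotalOrder isSTO public using (_<?_)

module _ {n : ℕ} where

  open LinearOrder

  IsAlmostBasis : Family n → Subset n → Set
  IsAlmostBasis 𝓒 D = ∃[ B ] ∃[ x ] (B ∈ᶠ 𝓒 × x ∈ B × D ≡ B - x)

  inU : Family n → Subset n → Fin n → Bool
  inU 𝓒 D x = not (lookup D x) ∧ 𝓒 (D +ₛ x)

  minBy : LinearOrder n → (Fin n → Bool) → List (Fin n) → Maybe (Fin n)
  minBy ρ P = foldr step nothing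
    where
    step : Fin n → Maybe (Fin n) → Maybe (Fin n)
    step x m with P x | m
    ... | false | _ = m
    ... | true | nothing = just x
    ... | true | just y = if does (_<?_ ρ x y) then just x else just y

  minU : LinearOrder n → Family n → Subset n → Maybe (Fin n)
  minU ρ 𝓒 D = minBy ρ (inU 𝓒 D) (allFin n)

  -- φ_ρ(D) = D + min_ρ U(D)  (only meaningful when D is an almost-basis,
  -- in which case U(D) is nonempty; otherwise junk value D)
  φ : LinearOrder n → Family n → Subset n → Subset n
  φ ρ 𝓒 D with minU ρ 𝓒 D
  ... | just x = D +ₛ x
  ... | nothing = D

  Consecutive : LinearOrder n → Fin n → Fin n → Set
  Consecutive ω a z = _<_ ω a z × (∀ c → ¬ (_<_ ω a c × _<_ ω c z))

  IsSwappedOrder : LinearOrder n → LinearOrder n → Fin n → Fin n → Set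
  IsSwappedOrder ω π a z = ∀ x y →
    (_<_ π x y → (_<_ ω x y × ¬ (x ≡ a × y ≡ z)) ⊎ (x ≡ z × y ≡ a)) ×
    ((_<_ ω x y × ¬ (x ≡ a × y ≡ z)) ⊎ (x ≡ z × y ≡ a) → _<_ π x y)

  IsBranching : LinearOrder n → LinearOrder n → Family n → Subset n → Set
  IsBranching ω π 𝓒 D = IsAlmostBasis 𝓒 D × φ ω 𝓒 D ≢ φ π 𝓒 D

  IsBranchingImage : LinearOrder n → LinearOrder n → Family n → Subset n → Set
  IsBranchingImage ω π 𝓒 B = B ∈ᶠ 𝓒 ×
    ∃[ A ] (IsBranching ω π 𝓒 A × (B ≡ φ ω 𝓒 A ⊎ B ≡ φ π 𝓒 A))

  -- ε is the transposition of a and z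
  IsBalancedAB : LinearOrder n → LinearOrder n → Fin n → Fin n → Family n → Subset n → Set
  IsBalancedAB ω π a z 𝓑 Q = IsAlmostBasis 𝓑 Q ×
    IsAlmostBasis 𝓑 (swapₛ a z Q) ×
    swapₛ a z (φ ω 𝓑 Q) ≡ φ π 𝓑 (swapₛ a z Q) ×
    swapₛ a z (φ π 𝓑 Q) ≡ φ ω 𝓑 (swapₛ a z Q)

  IsωBalanced : LinearOrder n → LinearOrder n → Fin n → Fin n → Family n → Subset n → Set
  IsωBalanced ω π a z 𝓑 B = B ∈ᶠ 𝓑 × swapₛ a z B ∈ᶠ 𝓑 ×
    (∀ Q → IsAlmostBasis 𝓑 Q → (φ ω 𝓑 Q ≡ B ⊎ φ π 𝓑 Q ≡ swapₛ a z B) →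
       IsBalancedAB ω π a z 𝓑 Q)

  IsπBalanced : LinearOrder n → LinearOrder n → Fin n → Fin n → Family n → Subset n → Set
  IsπBalanced ω π a z 𝓑 B = B ∈ᶠ 𝓑 × swapₛ a z B ∈ᶠ 𝓑 ×
    (∀ Q → IsAlmostBasis 𝓑 Q → (φ π 𝓑 Q ≡ B ⊎ φ ω 𝓑 Q ≡ swapₛ a z B) →
       IsBalancedAB ω π a z 𝓑 Q)

  IsBalancedBasis : LinearOrder n → LinearOrder n → Fin n → Fin n → Family n → Subset n → Set
  IsBalancedBasis ω π a z 𝓑 B = IsωBalanced ω π a z 𝓑 B × IsπBalanced ω π a z 𝓑 B

-- Since ω and π differ only on the adjacent pair a <ω z, an almost-basis A of 𝓑* branches
-- exactly when a and z are its ω- and π-least extensions.  Hence f B = A + e with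
-- e ∈ {a, z}, ε (f B) = A + e′ for the other element e′ of {a, z}, and the linking gives
-- ε B ∈ 𝓑 with f (ε B) = A + e′; in particular B and ε B differ on {a, z}.
-- Let Q be an almost-basis with φ_ω(Q) = B = Q + x.  Then x ≠ z, and x = a forces
-- ε Q = Q and φ_π(Q) = Q + z.  Otherwise x is also the least element of U(ε Q), for both
-- orders: a smaller y ∈ U(ε Q) outside {a, z} would, after transposing x and y and
-- exchanging in 𝓑*, give y ∈ U(A), so z <ω y; then an exchange in 𝓑 between Q + x and
-- ε Q + y produces an element of U(Q) below x.  The π-half of balancedness is the same
-- argument with (ω, a) and (π, z) interchanged.

module Submission where

open import Defs
open import Data.Bool using (Bool; true; false; not; _∧_; _∨_)
open import Data.Bool.Properties using (∨-zeroʳ; ∨-identityʳ; ∧-zeroʳ; ∧-identityʳ; ¬-not)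
open import Data.Empty using (⊥; ⊥-elim)
open import Data.Fin using (Fin; zero; suc; _≟_)
open import Data.Fin.Permutation.Components using (transpose; transpose-inverse)
open import Data.Fin.Subset using (Subset; _∈_; _∉_; ⁅_⁆; _-_)
open import Data.Fin.Subset.Properties using (p─⊥≡p)
open import Data.List using (List; []; _∷_)
open import Data.List.Base using (allFin)
open import Data.List.Membership.Propositional using () renaming (_∈_ to _∈ₗ_)
open import Data.List.Membership.Propositional.Properties using (∈-allFin)
open import Data.List.Relation.Unary.Any using (here; there)
open import Data.Maybe using (Maybe; just; nothing)
open import Data.Nat using (ℕ)
open import Data.Product using (_×_; _,_; proj₁; proj₂; ∃-syntax)
open import Data.Sum using (_⊎_; inj₁; inj₂; [_,_]′; map₂; swap)
open import Data.Vec using (_∷_; lookup)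
open import Data.Vec.Properties using (lookup-zipWith; lookup-replicate; lookup∘tabulate)
open import Data.Vec.Properties using (tabulate∘lookup; tabulate-cong; []=⇒lookup; lookup⇒[]=)
open import Function using (_∘_; id)
open import Relation.Binary.Definitions using (tri<; tri≈; tri>)
open import Relation.Binary.Structures using (IsStrictTotalOrder)
open import Relation.Binary.PropositionalEquality
open import Relation.Nullary using (¬_; Dec; does; yes; no)
open import Relation.Nullary.Decidable using (dec-true; dec-false)

private variable
  n : ℕ

false≢true : false ≢ true
false≢true ()

-- Transpositions of Fin n

transpose-left : (i j : Fin n) → transpose i j i ≡ j
transpose-left i j rewrite dec-true (i ≟ i) refl = refl

transpose-right : (i j : Fin n) → transpose i j j ≡ i
transpose-right i j with j ≟ i
... | yes j≡i = j≡i
... | no _ rewrite dec-true (j ≟ j) refl = refl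

transpose-other : (i j : Fin n) {k : Fin n} → k ≢ i → k ≢ j → transpose i j k ≡ k
transpose-other i j {k} k≢i k≢j rewrite dec-false (k ≟ i) k≢i | dec-false (k ≟ j) k≢j = refl

transpose-comm : (i j k : Fin n) → transpose i j k ≡ transpose j i k
transpose-comm i j k = by-cases (k ≟ i) (k ≟ j)
  where
  by-cases : Dec (k ≡ i) → Dec (k ≡ j) → transpose i j k ≡ transpose j i k
  by-cases (yes refl) _          = trans (transpose-left k j) (sym (transpose-right j k))
  by-cases (no _)     (yes refl) = trans (transpose-right i k) (sym (transpose-left k i))
  by-cases (no k≢i)   (no k≢j)   = trans (transpose-other i j k≢i k≢j) (sym (transpose-other j i k≢j k≢i))

transpose-involutive : (i j k : Fin n) → transpose i j (transpose i j k) ≡ k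
transpose-involutive i j k = trans (cong (transpose i j) (transpose-comm i j k)) (transpose-inverse i j)

does-transpose-≟ : (i j k x : Fin n) → does (transpose i j k ≟ x) ≡ does (k ≟ transpose i j x)
does-transpose-≟ i j k x with k ≟ transpose i j x
... | yes k≡tx = dec-true (transpose i j k ≟ x) (trans (cong (transpose i j) k≡tx) (transpose-involutive i j x))
... | no k≢tx = dec-false (transpose i j k ≟ x) λ tk≡x →
  k≢tx (trans (sym (transpose-involutive i j k)) (cong (transpose i j) tk≡x))

-- Subsets, elementwise

lookup-≗⇒≡ : {S T : Subset n} → (∀ k → lookup S k ≡ lookup T k) → S ≡ T
lookup-≗⇒≡ {S = S} {T} S≗T =
  trans (sym (tabulate∘lookup S)) (trans (tabulate-cong S≗T) (tabulate∘lookup T))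

lookup-⁅⁆ : (x k : Fin n) → lookup ⁅ x ⁆ k ≡ does (k ≟ x)
lookup-⁅⁆ zero    zero    = refl
lookup-⁅⁆ zero    (suc k) = lookup-replicate k false
lookup-⁅⁆ (suc x) zero    = refl
lookup-⁅⁆ (suc x) (suc k) = lookup-⁅⁆ x k

lookup-+ₛ : (S : Subset n) (x k : Fin n) → lookup (S +ₛ x) k ≡ lookup S k ∨ does (k ≟ x)
lookup-+ₛ S x k = trans (lookup-zipWith _∨_ k S ⁅ x ⁆) (cong (lookup S k ∨_) (lookup-⁅⁆ x k))

lookup-minus : (S : Subset n) (x k : Fin n) → lookup (S - x) k ≡ lookup S k ∧ not (does (k ≟ x))
lookup-minus (s ∷ S) zero    zero    = sym (∧-zeroʳ s)
lookup-minus (s ∷ S) zero    (suc k) = trans (cong (λ T → lookup T k) (p─⊥≡p S)) (sym (∧-identityʳ _))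
lookup-minus (s ∷ S) (suc x) zero    = sym (∧-identityʳ s)
lookup-minus (s ∷ S) (suc x) (suc k) = lookup-minus S x k

lookup-swapₛ : (i j : Fin n) (S : Subset n) (k : Fin n) → lookup (swapₛ i j S) k ≡ lookup S (transpose i j k)
lookup-swapₛ i j S = lookup∘tabulate (lookup S ∘ transpose i j)

lookup-+ₛ-self : (S : Subset n) (x : Fin n) → lookup (S +ₛ x) x ≡ true
lookup-+ₛ-self S x =
  trans (lookup-+ₛ S x x) (trans (cong (lookup S x ∨_) (dec-true (x ≟ x) refl)) (∨-zeroʳ _))

lookup-+ₛ-other : (S : Subset n) {x k : Fin n} → k ≢ x → lookup (S +ₛ x) k ≡ lookup S k
lookup-+ₛ-other S {x} {k} k≢x =
  trans (lookup-+ₛ S x k) (trans (cong (lookup S k ∨_) (dec-false (k ≟ x) k≢x)) (∨-identityʳ _))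

lookup-+ₛ-true : (S : Subset n) (x : Fin n) {k : Fin n} → lookup S k ≡ true → lookup (S +ₛ x) k ≡ true
lookup-+ₛ-true S x {k} Sk = trans (lookup-+ₛ S x k) (cong (_∨ does (k ≟ x)) Sk)

lookup-minus-self : (S : Subset n) (x : Fin n) → lookup (S - x) x ≡ false
lookup-minus-self S x =
  trans (lookup-minus S x x) (trans (cong (λ b → lookup S x ∧ not b) (dec-true (x ≟ x) refl)) (∧-zeroʳ _))

lookup-minus-other : (S : Subset n) {x k : Fin n} → k ≢ x → lookup (S - x) k ≡ lookup S k
lookup-minus-other S {x} {k} k≢x =
  trans (lookup-minus S x k) (trans (cong (λ b → lookup S k ∧ not b) (dec-false (k ≟ x) k≢x)) (∧-identityʳ _))

+ₛ-minus-cancel : (S : Subset n) (x : Fin n) → lookup S x ≡ false → (S +ₛ x) - x ≡ S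
+ₛ-minus-cancel S x Sx = lookup-≗⇒≡ λ k → by-cases k (k ≟ x)
  where
  by-cases : ∀ k → Dec (k ≡ x) → lookup ((S +ₛ x) - x) k ≡ lookup S k
  by-cases k (yes refl) = trans (lookup-minus-self (S +ₛ x) x) (sym Sx)
  by-cases k (no k≢x)   = trans (lookup-minus-other (S +ₛ x) k≢x) (lookup-+ₛ-other S k≢x)

minus-+ₛ-cancel : (S : Subset n) (x : Fin n) → lookup S x ≡ true → (S - x) +ₛ x ≡ S
minus-+ₛ-cancel S x Sx = lookup-≗⇒≡ λ k → by-cases k (k ≟ x)
  where
  by-cases : ∀ k → Dec (k ≡ x) → lookup ((S - x) +ₛ x) k ≡ lookup S k
  by-cases k (yes refl) = trans (lookup-+ₛ-self (S - x) x) (sym Sx)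
  by-cases k (no k≢x)   = trans (lookup-+ₛ-other (S - x) k≢x) (lookup-minus-other S k≢x)

lookup-swapₛ-left : (i j : Fin n) (S : Subset n) → lookup (swapₛ i j S) i ≡ lookup S j
lookup-swapₛ-left i j S = trans (lookup-swapₛ i j S i) (cong (lookup S) (transpose-left i j))

lookup-swapₛ-other : (i j : Fin n) (S : Subset n) {k : Fin n} → k ≢ i → k ≢ j →
                     lookup (swapₛ i j S) k ≡ lookup S k
lookup-swapₛ-other i j S {k} k≢i k≢j =
  trans (lookup-swapₛ i j S k) (cong (lookup S) (transpose-other i j k≢i k≢j))

swapₛ-comm : (i j : Fin n) (S : Subset n) → swapₛ i j S ≡ swapₛ j i S
swapₛ-comm i j S = tabulate-cong λ k → cong (lookup S) (transpose-comm i j k)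

swapₛ-involutive : (i j : Fin n) (S : Subset n) → swapₛ i j (swapₛ i j S) ≡ S
swapₛ-involutive i j S = lookup-≗⇒≡ λ k → begin
  lookup (swapₛ i j (swapₛ i j S)) k       ≡⟨ lookup-swapₛ i j (swapₛ i j S) k ⟩
  lookup (swapₛ i j S) (transpose i j k)   ≡⟨ lookup-swapₛ i j S (transpose i j k) ⟩
  lookup S (transpose i j (transpose i j k)) ≡⟨ cong (lookup S) (transpose-involutive i j k) ⟩
  lookup S k                                ∎
  where open ≡-Reasoning

swapₛ-fix : (i j : Fin n) (S : Subset n) → lookup S i ≡ lookup S j → swapₛ i j S ≡ S
swapₛ-fix i j S Si≡Sj = lookup-≗⇒≡ λ k → trans (lookup-swapₛ i j S k) (by-cases k (k ≟ i) (k ≟ j))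
  where
  by-cases : ∀ k → Dec (k ≡ i) → Dec (k ≡ j) → lookup S (transpose i j k) ≡ lookup S k
  by-cases k (yes refl) _          = trans (cong (lookup S) (transpose-left k j)) (sym Si≡Sj)
  by-cases k (no _)     (yes refl) = trans (cong (lookup S) (transpose-right i k)) Si≡Sj
  by-cases k (no k≢i)   (no k≢j)   = cong (lookup S) (transpose-other i j k≢i k≢j)

swapₛ-+ₛ : (i j : Fin n) (S : Subset n) (x : Fin n) →
           swapₛ i j (S +ₛ x) ≡ swapₛ i j S +ₛ transpose i j x
swapₛ-+ₛ i j S x = lookup-≗⇒≡ λ k → begin
  lookup (swapₛ i j (S +ₛ x)) k                            ≡⟨ lookup-swapₛ i j (S +ₛ x) k ⟩
  lookup (S +ₛ x) (transpose i j k)                        ≡⟨ lookup-+ₛ S x (transpose i j k) ⟩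
  lookup S (transpose i j k) ∨ does (transpose i j k ≟ x)
    ≡⟨ cong₂ _∨_ (sym (lookup-swapₛ i j S k)) (does-transpose-≟ i j k x) ⟩
  lookup (swapₛ i j S) k ∨ does (k ≟ transpose i j x)
    ≡⟨ lookup-+ₛ (swapₛ i j S) (transpose i j x) k ⟨
  lookup (swapₛ i j S +ₛ transpose i j x) k                ∎
  where open ≡-Reasoning

swapₛ-+ₛ-other : (i j : Fin n) (S : Subset n) {x : Fin n} → x ≢ i → x ≢ j →
                 swapₛ i j (S +ₛ x) ≡ swapₛ i j S +ₛ x
swapₛ-+ₛ-other i j S {x} x≢i x≢j =
  trans (swapₛ-+ₛ i j S x) (cong (swapₛ i j S +ₛ_) (transpose-other i j x≢i x≢j))

swapₛ-+ₛ-left : (i j : Fin n) (S : Subset n) → lookup S i ≡ lookup S j → swapₛ i j (S +ₛ i) ≡ S +ₛ j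
swapₛ-+ₛ-left i j S Si≡Sj = begin
  swapₛ i j (S +ₛ i)                ≡⟨ swapₛ-+ₛ i j S i ⟩
  swapₛ i j S +ₛ transpose i j i    ≡⟨ cong₂ _+ₛ_ (swapₛ-fix i j S Si≡Sj) (transpose-left i j) ⟩
  S +ₛ j                            ∎
  where open ≡-Reasoning

swapₛ-+ₛ-right : (i j : Fin n) (S : Subset n) → lookup S i ≡ lookup S j → swapₛ i j (S +ₛ j) ≡ S +ₛ i
swapₛ-+ₛ-right i j S Si≡Sj = trans (swapₛ-comm i j (S +ₛ j)) (swapₛ-+ₛ-left j i S (sym Si≡Sj))

swapₛ-+ₛ-exchange : (i j : Fin n) (S : Subset n) → lookup S i ≡ true → swapₛ i j S +ₛ i ≡ S +ₛ j
swapₛ-+ₛ-exchange i j S Si = begin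
  swapₛ i j S +ₛ i                  ≡⟨ cong (swapₛ i j S +ₛ_) (transpose-right i j) ⟨
  swapₛ i j S +ₛ transpose i j j    ≡⟨ swapₛ-+ₛ i j S j ⟨
  swapₛ i j (S +ₛ j)                ≡⟨ swapₛ-fix i j (S +ₛ j) S+j∋i,j ⟩
  S +ₛ j                            ∎
  where
  open ≡-Reasoning
  S+j∋i,j : lookup (S +ₛ j) i ≡ lookup (S +ₛ j) j
  S+j∋i,j = trans (lookup-+ₛ-true S j Si) (sym (lookup-+ₛ-self S j))

∉⇒lookup : {S : Subset n} {x : Fin n} → x ∉ S → lookup S x ≡ false
∉⇒lookup {S = S} {x} x∉S with lookup S x in Sx
... | true  = ⊥-elim (x∉S (lookup⇒[]= x S Sx))
... | false = refl

lookup⇒∉ : {S : Subset n} {x : Fin n} → lookup S x ≡ false → x ∉ S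
lookup⇒∉ Sx x∈S with () ← trans (sym Sx) ([]=⇒lookup x∈S)

-- U(D) and the maps φ

inU⁺ : (𝓒 : Family n) {D : Subset n} {x : Fin n} →
       lookup D x ≡ false → D +ₛ x ∈ᶠ 𝓒 → inU 𝓒 D x ≡ true
inU⁺ 𝓒 Dx D+x rewrite Dx | D+x = refl

inU⁻ : (𝓒 : Family n) (D : Subset n) (x : Fin n) →
       inU 𝓒 D x ≡ true → lookup D x ≡ false × D +ₛ x ∈ᶠ 𝓒
inU⁻ 𝓒 D x x∈U with lookup D x | 𝓒 (D +ₛ x)
... | false | true = refl , refl

almostBasis⇒inU : (𝓒 : Family n) {D : Subset n} → IsAlmostBasis 𝓒 D → ∃[ x ] inU 𝓒 D x ≡ true
almostBasis⇒inU 𝓒 (B , x , B∈𝓒 , x∈B , refl) =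
  x , inU⁺ 𝓒 (lookup-minus-self B x)
             (subst (_∈ᶠ 𝓒) (sym (minus-+ₛ-cancel B x ([]=⇒lookup x∈B))) B∈𝓒)

inU-swapₛ : (𝓒 : Family n) {D : Subset n} {i j : Fin n} → lookup D i ≢ lookup D j →
            inU 𝓒 (swapₛ i j D) i ≡ true → inU 𝓒 D j ≡ true
inU-swapₛ 𝓒 {D} {i} {j} Di≢Dj i∈U =
  inU⁺ 𝓒 Dj (subst (_∈ᶠ 𝓒) (swapₛ-+ₛ-exchange i j D Di) D′+i∈𝓒)
  where
  Dj : lookup D j ≡ false
  Dj = trans (sym (lookup-swapₛ-left i j D)) (proj₁ (inU⁻ 𝓒 _ i i∈U))
  Di : lookup D i ≡ true
  Di = trans (¬-not Di≢Dj) (cong not Dj)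
  D′+i∈𝓒 : swapₛ i j D +ₛ i ∈ᶠ 𝓒
  D′+i∈𝓒 = proj₂ (inU⁻ 𝓒 _ i i∈U)

Least : LinearOrder n → (Fin n → Bool) → Fin n → Set
Least ρ P m = P m ≡ true × (∀ y → P y ≡ true → m ≡ y ⊎ LinearOrder._<_ ρ m y)

module _ (ρ : LinearOrder n) where
  open LinearOrder ρ
  open IsStrictTotalOrder isSTO using (compare; asym) renaming (trans to <-trans)

  least-unique : ∀ {P m m′} → Least ρ P m → Least ρ P m′ → m ≡ m′
  least-unique (Pm , m≤) (Pm′ , m′≤) with m≤ _ Pm′ | m′≤ _ Pm
  ... | inj₁ m≡m′ | _          = m≡m′
  ... | inj₂ _    | inj₁ m′≡m  = sym m′≡m
  ... | inj₂ m<m′ | inj₂ m′<m  = ⊥-elim (asym m<m′ m′<m)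

  private
    LeastIn : (Fin n → Bool) → List (Fin n) → Maybe (Fin n) → Set
    LeastIn P L nothing  = ∀ y → y ∈ₗ L → P y ≡ false
    LeastIn P L (just m) = P m ≡ true × (∀ y → y ∈ₗ L → P y ≡ true → m ≡ y ⊎ m < y)

    minBy-leastIn : ∀ P L → LeastIn P L (minBy ρ P L)
    minBy-leastIn P [] = λ _ ()
    minBy-leastIn P (x ∷ L) with P x in Px | minBy ρ P L | minBy-leastIn P L
    ... | false | nothing | none = λ { y (here refl) → Px ; y (there y∈L) → none y y∈L }
    ... | false | just m  | (Pm , m≤) = Pm , λ
      { y (here refl) Py → ⊥-elim (false≢true (trans (sym Px) Py))
      ; y (there y∈L) Py → m≤ y y∈L Py }
    ... | true  | nothing | none = Px , λ
      { y (here refl) _  → inj₁ refl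
      ; y (there y∈L) Py → ⊥-elim (false≢true (trans (sym (none y y∈L)) Py)) }
    ... | true  | just m  | (Pm , m≤) with x <? m
    ...   | yes x<m = Px , λ
      { y (here refl) _  → inj₁ refl
      ; y (there y∈L) Py →
          [ (λ { refl → inj₂ x<m }) , (λ m<y → inj₂ (<-trans x<m m<y)) ]′ (m≤ y y∈L Py) }
    ...   | no x≮m = Pm , λ
      { y (here refl) _  → m≤x
      ; y (there y∈L) Py → m≤ y y∈L Py }
      where
      m≤x : m ≡ x ⊎ m < x
      m≤x with compare m x
      ... | tri< m<x _ _ = inj₂ m<x
      ... | tri≈ _ m≡x _ = inj₁ m≡x
      ... | tri> _ _ x<m = ⊥-elim (x≮m x<m)

  φ-least : (𝓒 : Family n) (D : Subset n) → IsAlmostBasis 𝓒 D →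
            ∃[ m ] Least ρ (inU 𝓒 D) m × φ ρ 𝓒 D ≡ D +ₛ m
  φ-least 𝓒 D D-ab with minU ρ 𝓒 D | minBy-leastIn (inU 𝓒 D) (allFin n)
  ... | just m  | (Um , m≤) = m , (Um , λ y Uy → m≤ y (∈-allFin y) Uy) , refl
  ... | nothing | none with almostBasis⇒inU 𝓒 D-ab
  ...   | x , x∈U = ⊥-elim (false≢true (trans (sym (none x (∈-allFin x))) x∈U))

  φ-≡-least : (𝓒 : Family n) (D : Subset n) {m : Fin n} → IsAlmostBasis 𝓒 D →
              Least ρ (inU 𝓒 D) m → φ ρ 𝓒 D ≡ D +ₛ m
  φ-≡-least 𝓒 D D-ab m-least with φ-least 𝓒 D D-ab
  ... | m′ , m′-least , φD≡ = trans φD≡ (cong (D +ₛ_) (least-unique m′-least m-least))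

-- Two linear orders differing by one adjacent transposition

module SwappedPair (ω π : LinearOrder n) (a z : Fin n)
                   (cons : Consecutive ω a z) (sw : IsSwappedOrder ω π a z) where

  open LinearOrder ω using () renaming (_<_ to _<ω_)
  open LinearOrder π using () renaming (_<_ to _<π_)
  open IsStrictTotalOrder (LinearOrder.isSTO ω) using ()
    renaming (trans to <ω-trans; irrefl to <ω-irrefl; asym to <ω-asym; compare to <ω-compare)
  open IsStrictTotalOrder (LinearOrder.isSTO π) using () renaming (irrefl to <π-irrefl)

  a<ωz : a <ω z
  a<ωz = proj₁ cons

  nothing-between : ∀ {c} → a <ω c → c <ω z → ⊥
  nothing-between a<c c<z = proj₂ cons _ (a<c , c<z)

  a≢z : a ≢ z
  a≢z a≡z = <ω-irrefl a≡z a<ωz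

  z<πa : z <π a
  z<πa = proj₂ (sw z a) (inj₂ (refl , refl))

  <ω⇒<π : ∀ {x y} → x <ω y → ¬ (x ≡ a × y ≡ z) → x <π y
  <ω⇒<π x<y ¬az = proj₂ (sw _ _) (inj₁ (x<y , ¬az))

  <π⇒<ω : ∀ {x y} → x <π y → ¬ (x ≡ z × y ≡ a) → x <ω y
  <π⇒<ω {x} {y} x<y ¬za with proj₁ (sw x y) x<y
  ... | inj₁ (x<ωy , _) = x<ωy
  ... | inj₂ za         = ⊥-elim (¬za za)

  below-a-or-above-z : ∀ {x} → x ≢ a → x ≢ z → x <ω a ⊎ z <ω x
  below-a-or-above-z {x} x≢a x≢z with <ω-compare x a
  ... | tri< x<a _ _ = inj₁ x<a
  ... | tri≈ _ x≡a _ = ⊥-elim (x≢a x≡a)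
  ... | tri> _ _ a<x with <ω-compare x z
  ...   | tri< x<z _ _ = ⊥-elim (nothing-between a<x x<z)
  ...   | tri≈ _ x≡z _ = ⊥-elim (x≢z x≡z)
  ...   | tri> _ _ z<x = inj₂ z<x

  least-ω⇒least-π : ∀ {P m} → Least ω P m → m ≢ a → Least π P m
  least-ω⇒least-π (Pm , m≤) m≢a =
    Pm , λ y Py → map₂ (λ m<y → <ω⇒<π m<y (m≢a ∘ proj₁)) (m≤ y Py)

  least-ω-a⇒least-π-z : ∀ {P} → Least ω P a → P z ≡ true → Least π P z
  least-ω-a⇒least-π-z {P} (Pa , a≤) Pz = Pz , z≤
    where
    z≤ : ∀ y → P y ≡ true → z ≡ y ⊎ z <π y
    z≤ y Py with a≤ y Py
    ... | inj₁ refl = inj₂ z<πa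
    ... | inj₂ a<y with <ω-compare z y
    ...   | tri< z<y _ _ = inj₂ (<ω⇒<π z<y (a≢z ∘ sym ∘ proj₁))
    ...   | tri≈ _ z≡y _ = inj₁ z≡y
    ...   | tri> _ _ y<z = ⊥-elim (nothing-between a<y y<z)

  least-ω≢least-π : ∀ {P m m′} → Least ω P m → Least π P m′ → m ≢ m′ → m ≡ a × m′ ≡ z
  least-ω≢least-π (Pm , m≤) (Pm′ , m′≤) m≢m′ with m≤ _ Pm′ | m′≤ _ Pm
  ... | inj₁ m≡m′  | _          = ⊥-elim (m≢m′ m≡m′)
  ... | inj₂ _     | inj₁ m′≡m  = ⊥-elim (m≢m′ (sym m′≡m))
  ... | inj₂ m<ωm′ | inj₂ m′<πm with proj₁ (sw _ _) m′<πm
  ...   | inj₁ (m′<ωm , _)  = ⊥-elim (<ω-asym m<ωm′ m′<ωm)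
  ...   | inj₂ (m′≡z , m≡a) = m≡a , m′≡z

  consecutive-π : Consecutive π z a
  consecutive-π = z<πa , λ c (z<c , c<a) → between c z<c c<a
    where
    between : ∀ c → z <π c → c <π a → ⊥
    between c z<c c<a with c ≟ a | c ≟ z
    ... | yes refl | _        = <π-irrefl refl c<a
    ... | no _     | yes refl = <π-irrefl refl z<c
    ... | no c≢a   | no c≢z   =
      <ω-asym (<ω-trans (<π⇒<ω z<c (c≢a ∘ proj₂)) (<π⇒<ω c<a (c≢z ∘ proj₁))) a<ωz

  swapped-π : IsSwappedOrder π ω z a
  swapped-π x y = to , from
    where
    z≮ωa : ∀ {x y} → x <ω y → ¬ (x ≡ z × y ≡ a)
    z≮ωa x<y (refl , refl) = <ω-asym x<y a<ωz
    to : x <ω y → (x <π y × ¬ (x ≡ z × y ≡ a)) ⊎ (x ≡ a × y ≡ z)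
    to x<y with x ≟ a | y ≟ z
    ... | yes refl | yes refl = inj₂ (refl , refl)
    ... | yes refl | no y≢z   = inj₁ (<ω⇒<π x<y (y≢z ∘ proj₂) , z≮ωa x<y)
    ... | no x≢a   | _        = inj₁ (<ω⇒<π x<y (x≢a ∘ proj₁) , z≮ωa x<y)
    from : (x <π y × ¬ (x ≡ z × y ≡ a)) ⊎ (x ≡ a × y ≡ z) → x <ω y
    from (inj₁ (x<y , ¬za))  = <π⇒<ω x<y ¬za
    from (inj₂ (refl , refl)) = a<ωz

-- Balanced almost-bases below a branching image

module Balancing {𝓑 𝓑* : Family n} (M : IsMatroid 𝓑) (M* : IsMatroid 𝓑*)
                 {f : Subset n → Subset n} (L : IsLinking 𝓑 𝓑* f)
                 (ω π : LinearOrder n) (a z : Fin n)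
                 (cons : Consecutive ω a z) (sw : IsSwappedOrder ω π a z) where

  open SwappedPair ω π a z cons sw
  open LinearOrder ω using () renaming (_<_ to _<ω_)
  open IsStrictTotalOrder (LinearOrder.isSTO ω) using ()
    renaming (trans to <ω-trans; irrefl to <ω-irrefl; asym to <ω-asym; compare to <ω-compare)

  ε : Subset n → Subset n
  ε = swapₛ a z

  f∈𝓑* : ∀ {B} → B ∈ᶠ 𝓑 → f B ∈ᶠ 𝓑*
  f∈𝓑* = proj₁ (proj₁ L) _

  swap-linked : ∀ {B i j} → B ∈ᶠ 𝓑 → i ≢ j → swapₛ i j B ∈ᶠ 𝓑 →
                swapₛ i j (f B) ∈ᶠ 𝓑* × swapₛ i j (f B) ≡ f (swapₛ i j B)
  swap-linked B∈𝓑 i≢j = proj₁ (proj₂ L _ _ _ B∈𝓑 i≢j)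

  swap-linked⁻ : ∀ {B i j} → B ∈ᶠ 𝓑 → i ≢ j → swapₛ i j (f B) ∈ᶠ 𝓑* →
                 swapₛ i j B ∈ᶠ 𝓑 × swapₛ i j (f B) ≡ f (swapₛ i j B)
  swap-linked⁻ B∈𝓑 i≢j = proj₂ (proj₂ L _ _ _ B∈𝓑 i≢j)

  ≢a,z : ∀ {e w} → e ≡ a ⊎ e ≡ z → w ≢ a → w ≢ z → e ≢ w
  ≢a,z (inj₁ refl) w≢a _ refl = w≢a refl
  ≢a,z (inj₂ refl) _ w≢z refl = w≢z refl

  module LeastExtension {Q : Subset n} {x : Fin n} (x-least : Least ω (inU 𝓑 Q) x)
                        (εB∈𝓑 : ε (Q +ₛ x) ∈ᶠ 𝓑)
                        (separated : lookup (Q +ₛ x) a ≢ lookup (Q +ₛ x) z) where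

    Qx : lookup Q x ≡ false
    Qx = proj₁ (inU⁻ 𝓑 Q x (proj₁ x-least))

    x≤ : ∀ y → inU 𝓑 Q y ≡ true → x ≡ y ⊎ x <ω y
    x≤ = proj₂ x-least

    least≢z : x ≢ z
    least≢z refl = [ a≢z ∘ sym , (λ z<a → <ω-asym z<a a<ωz) ]′ (x≤ a a∈U)
      where
      Qa : lookup Q a ≡ false
      Qa = trans (sym (lookup-+ₛ-other Q a≢z)) (trans (¬-not separated) (cong not (lookup-+ₛ-self Q z)))
      a∈U : inU 𝓑 Q a ≡ true
      a∈U = inU⁺ 𝓑 Qa (subst (_∈ᶠ 𝓑) (swapₛ-+ₛ-right a z Q (trans Qa (sym Qx))) εB∈𝓑)

    balanced-at-a : IsAlmostBasis 𝓑 Q → x ≡ a → IsBalancedAB ω π a z 𝓑 Q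
    balanced-at-a Q-ab refl = Q-ab , subst (IsAlmostBasis 𝓑) (sym εQ≡Q) Q-ab , εφω≡ , εφπ≡
      where
      open ≡-Reasoning
      Qz : lookup Q z ≡ false
      Qz = trans (sym (lookup-+ₛ-other Q (a≢z ∘ sym)))
                 (trans (¬-not (separated ∘ sym)) (cong not (lookup-+ₛ-self Q a)))
      εQ≡Q : ε Q ≡ Q
      εQ≡Q = swapₛ-fix a z Q (trans Qx (sym Qz))
      φωQ : φ ω 𝓑 Q ≡ Q +ₛ a
      φωQ = φ-≡-least ω 𝓑 Q Q-ab x-least
      φπQ : φ π 𝓑 Q ≡ Q +ₛ z
      φπQ = φ-≡-least π 𝓑 Q Q-ab (least-ω-a⇒least-π-z x-least
              (inU⁺ 𝓑 Qz (subst (_∈ᶠ 𝓑) (swapₛ-+ₛ-left a z Q (trans Qx (sym Qz))) εB∈𝓑)))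
      εφω≡ : ε (φ ω 𝓑 Q) ≡ φ π 𝓑 (ε Q)
      εφω≡ = begin
        ε (φ ω 𝓑 Q)   ≡⟨ cong ε φωQ ⟩
        ε (Q +ₛ a)    ≡⟨ swapₛ-+ₛ-left a z Q (trans Qx (sym Qz)) ⟩
        Q +ₛ z        ≡⟨ φπQ ⟨
        φ π 𝓑 Q       ≡⟨ cong (φ π 𝓑) εQ≡Q ⟨
        φ π 𝓑 (ε Q)   ∎
      εφπ≡ : ε (φ π 𝓑 Q) ≡ φ ω 𝓑 (ε Q)
      εφπ≡ = begin
        ε (φ π 𝓑 Q)   ≡⟨ cong ε φπQ ⟩
        ε (Q +ₛ z)    ≡⟨ swapₛ-+ₛ-right a z Q (trans Qx (sym Qz)) ⟩
        Q +ₛ a        ≡⟨ φωQ ⟨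
        φ ω 𝓑 Q       ≡⟨ cong (φ ω 𝓑) εQ≡Q ⟨
        φ ω 𝓑 (ε Q)   ∎

    module Outside (x≢a : x ≢ a) (x≢z : x ≢ z) where

      Q-separated : lookup Q a ≢ lookup Q z
      Q-separated Qa≡Qz = separated (begin
        lookup (Q +ₛ x) a   ≡⟨ lookup-+ₛ-other Q (x≢a ∘ sym) ⟩
        lookup Q a          ≡⟨ Qa≡Qz ⟩
        lookup Q z          ≡⟨ lookup-+ₛ-other Q (x≢z ∘ sym) ⟨
        lookup (Q +ₛ x) z   ∎)
        where open ≡-Reasoning

      εB≡ : ε (Q +ₛ x) ≡ ε Q +ₛ x
      εB≡ = swapₛ-+ₛ-other a z Q x≢a x≢z

      εQx : lookup (ε Q) x ≡ false
      εQx = trans (lookup-swapₛ-other a z Q x≢a x≢z) Qx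

      εQ-ab : IsAlmostBasis 𝓑 (ε Q)
      εQ-ab = ε Q +ₛ x , x , subst (_∈ᶠ 𝓑) εB≡ εB∈𝓑 , lookup⇒[]= x _ (lookup-+ₛ-self (ε Q) x) ,
              sym (+ₛ-minus-cancel (ε Q) x εQx)

      x<ωa : inU 𝓑 (ε Q) a ≡ true ⊎ inU 𝓑 (ε Q) z ≡ true → x <ω a
      x<ωa (inj₁ a∈U) with x≤ z (inU-swapₛ 𝓑 Q-separated a∈U)
      ... | inj₁ x≡z = ⊥-elim (x≢z x≡z)
      ... | inj₂ x<z = [ id , (λ z<x → ⊥-elim (<ω-asym x<z z<x)) ]′ (below-a-or-above-z x≢a x≢z)
      x<ωa (inj₂ z∈U)
        with x≤ a (inU-swapₛ 𝓑 (Q-separated ∘ sym) (subst (λ D → inU 𝓑 D z ≡ true) (swapₛ-comm a z Q) z∈U))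
      ... | inj₁ x≡a = ⊥-elim (x≢a x≡a)
      ... | inj₂ x<a = x<a

      -- The exchange axiom from Q + x towards ε Q + y yields some w ∈ U(Q), hence x <ω w.
      no-gap-above-z : ∀ {y} → inU 𝓑 (ε Q) y ≡ true → y ≢ a → y ≢ z → z <ω y → y <ω x → ⊥
      no-gap-above-z {y} y∈U y≢a y≢z z<y y<x = from-exchange
        (proj₂ M (Q +ₛ x) (ε Q +ₛ y) x
                 (proj₂ (inU⁻ 𝓑 Q x (proj₁ x-least))) (proj₂ (inU⁻ 𝓑 (ε Q) y y∈U))
                 (lookup⇒[]= x _ (lookup-+ₛ-self Q x))
                 (lookup⇒∉ (trans (lookup-+ₛ-other (ε Q) λ x≡y → <ω-irrefl (sym x≡y) y<x) εQx)))
        where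
        from-exchange : ∃[ w ] (w ∈ ε Q +ₛ y × w ∉ Q +ₛ x × ((Q +ₛ x) - x) +ₛ w ∈ᶠ 𝓑) → ⊥
        from-exchange (w , w∈ , w∉ , W∈𝓑) = misplaced (w ≟ y) (w ≟ a) (w ≟ z)
          where
          w≢x : w ≢ x
          w≢x refl = w∉ (lookup⇒[]= x _ (lookup-+ₛ-self Q x))
          Qw : lookup Q w ≡ false
          Qw = trans (sym (lookup-+ₛ-other Q w≢x)) (∉⇒lookup w∉)
          x<w : x <ω w
          x<w = [ (λ x≡w → ⊥-elim (w≢x (sym x≡w))) , id ]′
                  (x≤ w (inU⁺ 𝓑 Qw (subst (λ D → D +ₛ w ∈ᶠ 𝓑) (+ₛ-minus-cancel Q x Qx) W∈𝓑)))
          misplaced : Dec (w ≡ y) → Dec (w ≡ a) → Dec (w ≡ z) → ⊥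
          misplaced (yes refl) _          _          = <ω-asym x<w y<x
          misplaced (no _)     (yes refl) _          = <ω-asym x<w (<ω-trans a<ωz (<ω-trans z<y y<x))
          misplaced (no _)     (no _)     (yes refl) = <ω-asym x<w (<ω-trans z<y y<x)
          misplaced (no w≢y)   (no w≢a)   (no w≢z)   = false≢true (begin
            false                 ≡⟨ Qw ⟨
            lookup Q w            ≡⟨ lookup-swapₛ-other a z Q w≢a w≢z ⟨
            lookup (ε Q) w        ≡⟨ lookup-+ₛ-other (ε Q) w≢y ⟨
            lookup (ε Q +ₛ y) w   ≡⟨ []=⇒lookup w∈ ⟩
            true                  ∎)
            where open ≡-Reasoning

      balanced : (∀ {y} → inU 𝓑 (ε Q) y ≡ true → y ≢ a → y ≢ z → y <ω x → z <ω y) →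
                 IsAlmostBasis 𝓑 Q → IsBalancedAB ω π a z 𝓑 Q
      balanced below-x⇒above-z Q-ab = Q-ab , εQ-ab , εφω≡ , εφπ≡
        where
        open ≡-Reasoning
        x≤′ : ∀ y → inU 𝓑 (ε Q) y ≡ true → x ≡ y ⊎ x <ω y
        x≤′ y y∈U with y ≟ a | y ≟ z | <ω-compare x y
        ... | yes refl | _        | _            = inj₂ (x<ωa (inj₁ y∈U))
        ... | no _     | yes refl | _            = inj₂ (<ω-trans (x<ωa (inj₂ y∈U)) a<ωz)
        ... | no _     | no _     | tri< x<y _ _ = inj₂ x<y
        ... | no _     | no _     | tri≈ _ x≡y _ = inj₁ x≡y
        ... | no y≢a   | no y≢z   | tri> _ _ y<x =
          ⊥-elim (no-gap-above-z y∈U y≢a y≢z (below-x⇒above-z y∈U y≢a y≢z y<x) y<x)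
        x-least′ : Least ω (inU 𝓑 (ε Q)) x
        x-least′ = inU⁺ 𝓑 εQx (subst (_∈ᶠ 𝓑) εB≡ εB∈𝓑) , x≤′
        φωQ : φ ω 𝓑 Q ≡ Q +ₛ x
        φωQ = φ-≡-least ω 𝓑 Q Q-ab x-least
        φπQ : φ π 𝓑 Q ≡ Q +ₛ x
        φπQ = φ-≡-least π 𝓑 Q Q-ab (least-ω⇒least-π x-least x≢a)
        φωεQ : φ ω 𝓑 (ε Q) ≡ ε Q +ₛ x
        φωεQ = φ-≡-least ω 𝓑 (ε Q) εQ-ab x-least′
        φπεQ : φ π 𝓑 (ε Q) ≡ ε Q +ₛ x
        φπεQ = φ-≡-least π 𝓑 (ε Q) εQ-ab (least-ω⇒least-π x-least′ x≢a)
        εφω≡ : ε (φ ω 𝓑 Q) ≡ φ π 𝓑 (ε Q)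
        εφω≡ = begin
          ε (φ ω 𝓑 Q)   ≡⟨ cong ε φωQ ⟩
          ε (Q +ₛ x)    ≡⟨ εB≡ ⟩
          ε Q +ₛ x      ≡⟨ φπεQ ⟨
          φ π 𝓑 (ε Q)   ∎
        εφπ≡ : ε (φ π 𝓑 Q) ≡ φ ω 𝓑 (ε Q)
        εφπ≡ = begin
          ε (φ π 𝓑 Q)   ≡⟨ cong ε φπQ ⟩
          ε (Q +ₛ x)    ≡⟨ εB≡ ⟩
          ε Q +ₛ x      ≡⟨ φωεQ ⟨
          φ ω 𝓑 (ε Q)   ∎

  -- f B = A + e for an almost-basis A of 𝓑* whose ω- and π-least extensions are a and z.
  record BranchData (B : Subset n) : Set where
    field
      B∈𝓑      : B ∈ᶠ 𝓑
      εB∈𝓑     : ε B ∈ᶠ 𝓑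
      A        : Subset n
      e        : Fin n
      e∈az     : e ≡ a ⊎ e ≡ z
      Aa       : lookup A a ≡ false
      Az       : lookup A z ≡ false
      fB≡A+e   : f B ≡ A +ₛ e
      U*-above : ∀ {v} → inU 𝓑* A v ≡ true → v ≢ a → v ≢ z → z <ω v

  module Linked {B : Subset n} (H : BranchData B) where
    open BranchData H

    A∌ : ∀ {w} → w ≡ a ⊎ w ≡ z → lookup A w ≡ false
    A∌ (inj₁ refl) = Aa
    A∌ (inj₂ refl) = Az

    partner : ∃[ e′ ] (e′ ≡ a ⊎ e′ ≡ z) × e′ ≢ e × ε (A +ₛ e) ≡ A +ₛ e′
    partner with e∈az
    ... | inj₁ refl = z , inj₂ refl , a≢z ∘ sym , swapₛ-+ₛ-left a z A (trans Aa (sym Az))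
    ... | inj₂ refl = a , inj₁ refl , a≢z , swapₛ-+ₛ-right a z A (trans Aa (sym Az))

    e′ : Fin n
    e′ = proj₁ partner

    e′∈az : e′ ≡ a ⊎ e′ ≡ z
    e′∈az = proj₁ (proj₂ partner)

    e′≢e : e′ ≢ e
    e′≢e = proj₁ (proj₂ (proj₂ partner))

    fεB≡A+e′ : f (ε B) ≡ A +ₛ e′
    fεB≡A+e′ = begin
      f (ε B)      ≡⟨ proj₂ (swap-linked B∈𝓑 a≢z εB∈𝓑) ⟨
      ε (f B)      ≡⟨ cong ε fB≡A+e ⟩
      ε (A +ₛ e)   ≡⟨ proj₂ (proj₂ (proj₂ partner)) ⟩
      A +ₛ e′      ∎
      where open ≡-Reasoning

    A+e≢A+e′ : A +ₛ e ≢ A +ₛ e′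
    A+e≢A+e′ A+e≡A+e′ = false≢true (begin
      false                ≡⟨ A∌ e′∈az ⟨
      lookup A e′          ≡⟨ lookup-+ₛ-other A e′≢e ⟨
      lookup (A +ₛ e) e′   ≡⟨ cong (λ S → lookup S e′) A+e≡A+e′ ⟩
      lookup (A +ₛ e′) e′  ≡⟨ lookup-+ₛ-self A e′ ⟩
      true                 ∎)
      where open ≡-Reasoning

    separated : lookup B a ≢ lookup B z
    separated Ba≡Bz = A+e≢A+e′ (begin
      A +ₛ e    ≡⟨ fB≡A+e ⟨
      f B       ≡⟨ cong f (swapₛ-fix a z B Ba≡Bz) ⟨
      f (ε B)   ≡⟨ fεB≡A+e′ ⟩
      A +ₛ e′   ∎)
      where open ≡-Reasoning

  BranchData-ε : ∀ {B} → BranchData B → BranchData (ε B)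
  BranchData-ε {B} H = record
    { B∈𝓑 = εB∈𝓑 ; εB∈𝓑 = subst (_∈ᶠ 𝓑) (sym (swapₛ-involutive a z B)) B∈𝓑
    ; A = A ; e = e′ ; e∈az = e′∈az ; Aa = Aa ; Az = Az ; fB≡A+e = fεB≡A+e′ ; U*-above = U*-above }
    where
    open BranchData H
    open Linked H

  module AtLeast {Q : Subset n} {x : Fin n} (x-least : Least ω (inU 𝓑 Q) x)
                 (H : BranchData (Q +ₛ x)) (x≢a : x ≢ a) (x≢z : x ≢ z) where
    open BranchData H
    open Linked H
    open LeastExtension x-least εB∈𝓑 separated
    open Outside x≢a x≢z

    e≢x : e ≢ x
    e≢x = ≢a,z e∈az x≢a x≢z

    -- Transposing e and x in f B gives A + x ∈ 𝓑*, so Q + e ∈ 𝓑 by the linking,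
    -- i.e. e ∈ U(Q); but e lies below x.
    x∉U*A : inU 𝓑* A x ≡ true → ⊥
    x∉U*A x∈U* = [ e≢x ∘ sym , (λ x<e → <ω-asym x<e e<x) ]′ (x≤ e e∈U)
      where
      open ≡-Reasoning
      Ax : lookup A x ≡ false
      Ax = proj₁ (inU⁻ 𝓑* A x x∈U*)
      s : Subset n → Subset n
      s = swapₛ e x
      sfB≡A+x : s (f (Q +ₛ x)) ≡ A +ₛ x
      sfB≡A+x = trans (cong s fB≡A+e) (swapₛ-+ₛ-left e x A (trans (A∌ e∈az) (sym Ax)))
      sB-linked : s (Q +ₛ x) ∈ᶠ 𝓑 × s (f (Q +ₛ x)) ≡ f (s (Q +ₛ x))
      sB-linked =
        swap-linked⁻ B∈𝓑 e≢x (subst (_∈ᶠ 𝓑*) (sym sfB≡A+x) (proj₂ (inU⁻ 𝓑* A x x∈U*)))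
      Be≢Bx : lookup (Q +ₛ x) e ≢ lookup (Q +ₛ x) x
      Be≢Bx Be≡Bx = false≢true (begin
        false                ≡⟨ Ax ⟨
        lookup A x           ≡⟨ lookup-+ₛ-other A (e≢x ∘ sym) ⟨
        lookup (A +ₛ e) x    ≡⟨ cong (λ S → lookup S x) A+e≡A+x ⟩
        lookup (A +ₛ x) x    ≡⟨ lookup-+ₛ-self A x ⟩
        true                 ∎)
        where
        A+e≡A+x : A +ₛ e ≡ A +ₛ x
        A+e≡A+x = begin
          A +ₛ e                  ≡⟨ fB≡A+e ⟨
          f (Q +ₛ x)              ≡⟨ cong f (swapₛ-fix e x (Q +ₛ x) Be≡Bx) ⟨
          f (s (Q +ₛ x))          ≡⟨ proj₂ sB-linked ⟨
          s (f (Q +ₛ x))          ≡⟨ sfB≡A+x ⟩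
          A +ₛ x                  ∎
      Qe : lookup Q e ≡ false
      Qe = trans (sym (lookup-+ₛ-other Q e≢x)) (trans (¬-not Be≢Bx) (cong not (lookup-+ₛ-self Q x)))
      e∈U : inU 𝓑 Q e ≡ true
      e∈U = inU⁺ 𝓑 Qe (subst (_∈ᶠ 𝓑) (swapₛ-+ₛ-right e x Q (trans Qe (sym Qx))) (proj₁ sB-linked))
      e<x : e <ω x
      e<x with e∈az | U*-above x∈U* x≢a x≢z
      ... | inj₁ refl | z<x = <ω-trans a<ωz z<x
      ... | inj₂ refl | z<x = z<x

    -- Transposing x and y, the linking carries ε B ↦ ε Q + y ∈ 𝓑 but not B ↦ Q + y ∉ 𝓑;
    -- the exchange axiom of 𝓑* then puts y (or, impossibly, x) into U(A).
    module Below {y : Fin n} (y∈U : inU 𝓑 (ε Q) y ≡ true)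
                 (y≢a : y ≢ a) (y≢z : y ≢ z) (y<x : y <ω x) where

      open ≡-Reasoning

      t : Subset n → Subset n
      t = swapₛ x y

      x≢y : x ≢ y
      x≢y x≡y = <ω-irrefl (sym x≡y) y<x

      εQy : lookup (ε Q) y ≡ false
      εQy = proj₁ (inU⁻ 𝓑 (ε Q) y y∈U)

      Qy : lookup Q y ≡ false
      Qy = trans (sym (lookup-swapₛ-other a z Q y≢a y≢z)) εQy

      Q+y∉𝓑 : ¬ (Q +ₛ y ∈ᶠ 𝓑)
      Q+y∉𝓑 Q+y∈𝓑 with x≤ y (inU⁺ 𝓑 Qy Q+y∈𝓑)
      ... | inj₁ x≡y = x≢y x≡y
      ... | inj₂ x<y = <ω-asym x<y y<x

      tfB∉𝓑* : ¬ (t (f (Q +ₛ x)) ∈ᶠ 𝓑*)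
      tfB∉𝓑* tfB∈𝓑* = Q+y∉𝓑 (subst (_∈ᶠ 𝓑) (swapₛ-+ₛ-left x y Q (trans Qx (sym Qy)))
                                          (proj₁ (swap-linked⁻ B∈𝓑 x≢y tfB∈𝓑*)))

      tA+e′∈𝓑* : t (A +ₛ e′) ∈ᶠ 𝓑*
      tA+e′∈𝓑* = subst (λ S → t S ∈ᶠ 𝓑*) fεB≡A+e′ (proj₁ (swap-linked εB∈𝓑 x≢y tεB∈𝓑))
        where
        tεB∈𝓑 : t (ε (Q +ₛ x)) ∈ᶠ 𝓑
        tεB∈𝓑 = subst (_∈ᶠ 𝓑) (sym (trans (cong t εB≡) (swapₛ-+ₛ-left x y (ε Q) εQx≡εQy)))
                       (proj₂ (inU⁻ 𝓑 (ε Q) y y∈U))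
          where
          εQx≡εQy : lookup (ε Q) x ≡ lookup (ε Q) y
          εQx≡εQy = trans εQx (sym εQy)

      Ax≢Ay : lookup A x ≢ lookup A y
      Ax≢Ay Ax≡Ay = tfB∉𝓑* (subst (_∈ᶠ 𝓑*) (sym tfB≡fB) (f∈𝓑* B∈𝓑))
        where
        tfB≡fB : t (f (Q +ₛ x)) ≡ f (Q +ₛ x)
        tfB≡fB = begin
          t (f (Q +ₛ x))  ≡⟨ cong t fB≡A+e ⟩
          t (A +ₛ e)      ≡⟨ swapₛ-fix x y (A +ₛ e) (begin
            lookup (A +ₛ e) x  ≡⟨ lookup-+ₛ-other A (e≢x ∘ sym) ⟩
            lookup A x         ≡⟨ Ax≡Ay ⟩
            lookup A y         ≡⟨ lookup-+ₛ-other A (≢a,z e∈az y≢a y≢z ∘ sym) ⟨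
            lookup (A +ₛ e) y  ∎) ⟩
          A +ₛ e          ≡⟨ fB≡A+e ⟨
          f (Q +ₛ x)      ∎

      e′≢x : e′ ≢ x
      e′≢x = ≢a,z e′∈az x≢a x≢z

      e′≢y : e′ ≢ y
      e′≢y = ≢a,z e′∈az y≢a y≢z

      exchanged : ∃[ w ] (w ∈ A +ₛ e × w ∉ t (A +ₛ e′) × t A +ₛ w ∈ᶠ 𝓑*)
      exchanged
        with proj₂ M* (t (A +ₛ e′)) (A +ₛ e) e′ tA+e′∈𝓑* (subst (_∈ᶠ 𝓑*) fB≡A+e (f∈𝓑* B∈𝓑))
               (lookup⇒[]= e′ _ (trans (lookup-swapₛ-other x y (A +ₛ e′) e′≢x e′≢y) (lookup-+ₛ-self A e′)))
               (lookup⇒∉ (trans (lookup-+ₛ-other A e′≢e) (A∌ e′∈az)))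
      ... | w , w∈ , w∉ , W∈𝓑* = w , w∈ , w∉ , subst (λ S → S +ₛ w ∈ᶠ 𝓑*) tA+e′-e′≡tA W∈𝓑*
        where
        tA+e′-e′≡tA : t (A +ₛ e′) - e′ ≡ t A
        tA+e′-e′≡tA =
          trans (cong (_- e′) (swapₛ-+ₛ-other x y A e′≢x e′≢y))
                (+ₛ-minus-cancel (t A) e′ (trans (lookup-swapₛ-other x y A e′≢x e′≢y) (A∌ e′∈az)))

      moved-in-A : ∀ {w} → lookup A w ≡ true → w ∉ t (A +ₛ e′) → t A +ₛ w ∈ᶠ 𝓑* → z <ω y
      moved-in-A {w} Aw w∉ tA+w∈𝓑* with w ≟ x | w ≟ y
      ... | yes refl | _        = U*-above (inU⁺ 𝓑* Ay A+y∈𝓑*) y≢a y≢z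
        where
        Ay : lookup A y ≡ false
        Ay = trans (¬-not (Ax≢Ay ∘ sym)) (cong not Aw)
        A+y∈𝓑* : A +ₛ y ∈ᶠ 𝓑*
        A+y∈𝓑* = subst (_∈ᶠ 𝓑*) (swapₛ-+ₛ-exchange x y A Aw) tA+w∈𝓑*
      ... | no _     | yes refl = ⊥-elim (x∉U*A (inU⁺ 𝓑* Ax A+x∈𝓑*))
        where
        Ax : lookup A x ≡ false
        Ax = trans (¬-not Ax≢Ay) (cong not Aw)
        A+x∈𝓑* : A +ₛ x ∈ᶠ 𝓑*
        A+x∈𝓑* = subst (_∈ᶠ 𝓑*) (trans (cong (_+ₛ y) (swapₛ-comm x y A)) (swapₛ-+ₛ-exchange y x A Aw))
                       tA+w∈𝓑*
      ... | no w≢x   | no w≢y   =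
        ⊥-elim (w∉ (lookup⇒[]= w _
          (trans (lookup-swapₛ-other x y (A +ₛ e′) w≢x w≢y) (lookup-+ₛ-true A e′ Aw))))

      z<y : z <ω y
      z<y with exchanged
      ... | w , w∈ , w∉ , tA+w∈𝓑* with w ≟ e
      ...   | yes refl = ⊥-elim (tfB∉𝓑* (subst (_∈ᶠ 𝓑*) tA+e≡tfB tA+w∈𝓑*))
        where
        tA+e≡tfB : t A +ₛ e ≡ t (f (Q +ₛ x))
        tA+e≡tfB = sym (trans (cong t fB≡A+e) (swapₛ-+ₛ-other x y A e≢x (≢a,z e∈az y≢a y≢z)))
      ...   | no w≢e = moved-in-A (trans (sym (lookup-+ₛ-other A w≢e)) ([]=⇒lookup w∈)) w∉ tA+w∈𝓑*

  branching-data : ∀ {B} → B ∈ᶠ 𝓑 → IsBranchingImage ω π 𝓑* (f B) → BranchData B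
  branching-data {B} B∈𝓑 (_ , A , (A-ab , φωA≢φπA) , fB≡φA)
    with φ-least ω 𝓑* A A-ab | φ-least π 𝓑* A A-ab
  ... | m , m-least , φωA≡ | m′ , m′-least , φπA≡
    with least-ω≢least-π m-least m′-least
           (λ m≡m′ → φωA≢φπA (trans φωA≡ (trans (cong (A +ₛ_) m≡m′) (sym φπA≡))))
  ... | refl , refl = record
    { B∈𝓑 = B∈𝓑 ; εB∈𝓑 = proj₁ (swap-linked⁻ B∈𝓑 a≢z εfB∈𝓑*)
    ; A = A ; e = e ; e∈az = e∈az ; Aa = Aa ; Az = Az ; fB≡A+e = fB≡A+e ; U*-above = U*-above }
    where
    Aa : lookup A a ≡ false
    Aa = proj₁ (inU⁻ 𝓑* A a (proj₁ m-least))
    Az : lookup A z ≡ false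
    Az = proj₁ (inU⁻ 𝓑* A z (proj₁ m′-least))
    U*-above : ∀ {v} → inU 𝓑* A v ≡ true → v ≢ a → v ≢ z → z <ω v
    U*-above {v} v∈U* v≢a v≢z with proj₂ m-least v v∈U*
    ... | inj₁ a≡v = ⊥-elim (v≢a (sym a≡v))
    ... | inj₂ a<v = [ (λ v<a → ⊥-elim (<ω-asym a<v v<a)) , id ]′ (below-a-or-above-z v≢a v≢z)
    Aa≡Az : lookup A a ≡ lookup A z
    Aa≡Az = trans Aa (sym Az)
    chosen : ∃[ e ] (e ≡ a ⊎ e ≡ z) × f B ≡ A +ₛ e × ε (f B) ∈ᶠ 𝓑*
    chosen = [ via-a , via-z ]′ fB≡φA
      where
      via-a : f B ≡ φ ω 𝓑* A → ∃[ e ] (e ≡ a ⊎ e ≡ z) × f B ≡ A +ₛ e × ε (f B) ∈ᶠ 𝓑*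
      via-a fB≡φωA = a , inj₁ refl , trans fB≡φωA φωA≡ ,
        subst (_∈ᶠ 𝓑*) (sym (trans (cong ε (trans fB≡φωA φωA≡)) (swapₛ-+ₛ-left a z A Aa≡Az)))
              (proj₂ (inU⁻ 𝓑* A z (proj₁ m′-least)))
      via-z : f B ≡ φ π 𝓑* A → ∃[ e ] (e ≡ a ⊎ e ≡ z) × f B ≡ A +ₛ e × ε (f B) ∈ᶠ 𝓑*
      via-z fB≡φπA = z , inj₂ refl , trans fB≡φπA φπA≡ ,
        subst (_∈ᶠ 𝓑*) (sym (trans (cong ε (trans fB≡φπA φπA≡)) (swapₛ-+ₛ-right a z A Aa≡Az)))
              (proj₂ (inU⁻ 𝓑* A a (proj₁ m-least)))
    e : Fin n
    e = proj₁ chosen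
    e∈az : e ≡ a ⊎ e ≡ z
    e∈az = proj₁ (proj₂ chosen)
    fB≡A+e : f B ≡ A +ₛ e
    fB≡A+e = proj₁ (proj₂ (proj₂ chosen))
    εfB∈𝓑* : ε (f B) ∈ᶠ 𝓑*
    εfB∈𝓑* = proj₂ (proj₂ (proj₂ chosen))

  balanced-ω-preimage : ∀ {B} → BranchData B → ∀ Q → IsAlmostBasis 𝓑 Q → φ ω 𝓑 Q ≡ B →
                        IsBalancedAB ω π a z 𝓑 Q
  balanced-ω-preimage H Q Q-ab φωQ≡B with φ-least ω 𝓑 Q Q-ab
  ... | x , x-least , φωQ≡Q+x = by-cases (x ≟ a) (x ≟ z)
    where
    H′ : BranchData (Q +ₛ x)
    H′ = subst BranchData (trans (sym φωQ≡B) φωQ≡Q+x) H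
    open LeastExtension x-least (BranchData.εB∈𝓑 H′) (Linked.separated H′)
    by-cases : Dec (x ≡ a) → Dec (x ≡ z) → IsBalancedAB ω π a z 𝓑 Q
    by-cases (yes x≡a) _         = balanced-at-a Q-ab x≡a
    by-cases (no _)    (yes x≡z) = ⊥-elim (least≢z x≡z)
    by-cases (no x≢a)  (no x≢z)  = Outside.balanced x≢a x≢z (AtLeast.Below.z<y x-least H′ x≢a x≢z) Q-ab

isBalancedAB-swap : {ω π : LinearOrder n} {a z : Fin n} {𝓒 : Family n} {Q : Subset n} →
                    IsBalancedAB π ω z a 𝓒 Q → IsBalancedAB ω π a z 𝓒 Q
isBalancedAB-swap {ω = ω} {π} {a} {z} {𝓒} {Q} (Q-ab , εQ-ab , εφπ≡ , εφω≡) =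
  Q-ab , subst (IsAlmostBasis 𝓒) (swapₛ-comm z a Q) εQ-ab ,
  trans (swapₛ-comm a z (φ ω 𝓒 Q)) (trans εφω≡ (cong (φ π 𝓒) (swapₛ-comm z a Q))) ,
  trans (swapₛ-comm a z (φ π 𝓒 Q)) (trans εφπ≡ (cong (φ ω 𝓒) (swapₛ-comm z a Q)))

module BothOrders {𝓑 𝓑* : Family n} (M : IsMatroid 𝓑) (M* : IsMatroid 𝓑*)
                  {f : Subset n → Subset n} (L : IsLinking 𝓑 𝓑* f)
                  (ω π : LinearOrder n) (a z : Fin n)
                  (cons : Consecutive ω a z) (sw : IsSwappedOrder ω π a z) where

  open SwappedPair ω π a z cons sw using (consecutive-π; swapped-π; a<ωz; <ω⇒<π)
  open IsStrictTotalOrder (LinearOrder.isSTO ω) using () renaming (trans to <ω-trans)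

  module Bω = Balancing M M* L ω π a z cons sw
  module Bπ = Balancing M M* L π ω z a consecutive-π swapped-π

  branchData-π : ∀ {B} → Bω.BranchData B → Bπ.BranchData B
  branchData-π {B} H = record
    { B∈𝓑 = B∈𝓑 ; εB∈𝓑 = subst (_∈ᶠ 𝓑) (swapₛ-comm a z B) εB∈𝓑
    ; A = A ; e = e ; e∈az = swap e∈az ; Aa = Az ; Az = Aa ; fB≡A+e = fB≡A+e
    ; U*-above = λ v∈U* v≢z v≢a → <ω⇒<π (<ω-trans a<ωz (U*-above v∈U* v≢a v≢z)) (v≢z ∘ proj₂) }
    where open Bω.BranchData H

corollary9p2 : (n : ℕ) (𝓑 𝓑* : Family n) → IsMatroid 𝓑 → IsMatroid 𝓑* →
    (f : Subset n → Subset n) → IsLinking 𝓑 𝓑* f →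
    (ω π : LinearOrder n) (a z : Fin n) → a ≢ z → Consecutive ω a z →
    IsSwappedOrder ω π a z →
    (B : Subset n) → B ∈ᶠ 𝓑 → IsBranchingImage ω π 𝓑* (f B) →
    IsBalancedBasis ω π a z 𝓑 B
corollary9p2 n 𝓑 𝓑* M M* f L ω π a z _ cons sw B B∈𝓑 fB-branching =
  (B∈𝓑 , εB∈𝓑 , λ Q Q-ab →
     [ Bω.balanced-ω-preimage H Q Q-ab
     , isBalancedAB-swap ∘ Bπ.balanced-ω-preimage (branchData-π εH) Q Q-ab ]′) ,
  (B∈𝓑 , εB∈𝓑 , λ Q Q-ab →
     [ isBalancedAB-swap ∘ Bπ.balanced-ω-preimage (branchData-π H) Q Q-ab
     , Bω.balanced-ω-preimage εH Q Q-ab ]′)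
  where
  open BothOrders M M* L ω π a z cons sw
  H : Bω.BranchData B
  H = Bω.branching-data B∈𝓑 fB-branching
  εH : Bω.BranchData (swapₛ a z B)
  εH = Bω.BranchData-ε H
  εB∈𝓑 : swapₛ a z B ∈ᶠ 𝓑
  εB∈𝓑 = Bω.BranchData.εB∈𝓑 H
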